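{- Each of the algorithms \textsf{P}, \textsf{E}, \textsf{A}, \textsf{R}, \textsf{RA} (defined below) is correct: run on an undirected graph with vertex set $[n]$, when it stops, the parent pointers form exactly one flat tree per connected component of the input graph; that is, for every vertex $v$, $v.p$ is a vertex of the component of $v$ with $(v.p).p=v.p$, and two vertices have the same parent if and only if they lie in the same connected component.
   Context: Each edge $e$ has two ends $e.v,e.w$; the current edge set is initially the input edge set. Each vertex $v$ has a parent $v.p$, initially $v$; $v$ is a root if $v.p=v$. The algorithms keep the parent digraph acyclic apart from loops at roots, so it is a forest (the label forest) whose trees are rooted at roots; a tree is flat if every non-root vertex in it has the root as parent. Vertices are compared as integers. Each operation is performed simultaneously for all edges/vertices using values at the start of the operation. \textsc{connect}: for each edge $e$, send $\min\{e.v,e.w\}$ to $\max\{e.v,e.w\}$. \textsc{parent-connect}: for each edge $e$, let $x=e.v.p$, $y=e.w.p$; send $\min\{x,y\}$ to $\max\{x,y\}$. \textsc{extended-connect}: for each edge $e$, let $x=e.v.p$, $y=e.w.p$; if $y<x$ send $y$ to $e.v$ and to $x$, else send $x$ to $e.w$ and to $y$. \textsc{update}: for each vertex $v$, replace $v.p$ by the minimum of $v.p$ and the vertices sent to $v$ in the preceding connect operation. \textsc{root-update}: the same, but only for roots $v$. \textsc{shortcut}: for each vertex $v$, replace $v.p$ by $(v.p).p$. \textsc{alter}: for each edge $e$, let $x=e.v.p$, $y=e.w.p$; if $x=y$ delete $e$, else replace $e.v,e.w$ by $x,y$. Each algorithm repeats a round until a round in which no parent changes: \textsf{P}: \textsc{parent-connect};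 \textsc{update}; \textsc{shortcut}. \textsf{E}: \textsc{extended-connect}; \textsc{update}; \textsc{shortcut}. \textsf{A}: \textsc{connect}; \textsc{update}; \textsc{shortcut}; \textsc{alter}. \textsf{R}: \textsc{parent-connect}; \textsc{root-update}; \textsc{shortcut}. \textsf{RA}: \textsc{connect}; \textsc{root-update}; \textsc{shortcut}; \textsc{alter}. -}

module Defs where

open import Data.Nat as ℕ using (ℕ; zero; suc; _<ᵇ_)
open import Data.Fin using (Fin; toℕ; _≟_)
open import Data.Bool using (Bool; true; false; if_then_else_)
open import Data.List using (List; []; _∷_; _++_; concatMap; foldr)
open import Data.Product using (_×_; _,_; proj₁; proj₂)
open import Relation.Nullary using (¬_; yes; no)
open import Relation.Binary.PropositionalEquality using (_≡_)
open import Relation.Nullary using (Dec)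
open import Function using (_∘_)
open import Data.List.Membership.Propositional using (_∈_)

-- Vertices are Fin n, compared as integers via toℕ.
-- An (undirected) edge is an unordered pair, represented by its two ends (e.v , e.w).
Edge : ℕ → Set
Edge n = Fin n × Fin n

_<F_ : ∀ {n} → Fin n → Fin n → Bool
x <F y = toℕ x <ᵇ toℕ y

minF : ∀ {n} → Fin n → Fin n → Fin n
minF x y = if y <F x then y else x

maxF : ∀ {n} → Fin n → Fin n → Fin n
maxF x y = if y <F x then x else y

Parents : ℕ → Set
Parents n = Fin n → Fin n

-- A message (target , value): "send value to target".
Msg : ℕ → Set
Msg n = Fin n × Fin n

record State (n : ℕ) : Set where
  constructor st
  field
    par   : Parents n
    edges : List (Edge n)
open State public

connect : ∀ {n} → List (Edge n) → List (Msg n)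
connect = concatMap λ e → (maxF (proj₁ e) (proj₂ e) , minF (proj₁ e) (proj₂ e)) ∷ []

parent-connect : ∀ {n} → Parents n → List (Edge n) → List (Msg n)
parent-connect p = concatMap λ e →
  let x = p (proj₁ e) ; y = p (proj₂ e) in (maxF x y , minF x y) ∷ []

extended-connect : ∀ {n} → Parents n → List (Edge n) → List (Msg n)
extended-connect p = concatMap λ e →
  let x = p (proj₁ e) ; y = p (proj₂ e) in
  if y <F x then (proj₁ e , y) ∷ (x , y) ∷ []
            else (proj₂ e , x) ∷ (y , x) ∷ []

minSent : ∀ {n} → List (Msg n) → Fin n → Fin n → Fin n
minSent ms v a = foldr (λ m acc → if ⌊ proj₁ m ≟ v ⌋′ then minF (proj₂ m) acc else acc) a ms
  where
  ⌊_⌋′ : ∀ {P : Set} → Dec P → Bool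
  ⌊ yes _ ⌋′ = true
  ⌊ no _ ⌋′ = false

update : ∀ {n} → List (Msg n) → Parents n → Parents n
update ms p v = minSent ms v (p v)

root-update : ∀ {n} → List (Msg n) → Parents n → Parents n
root-update ms p v with p v ≟ v
... | yes _ = minSent ms v (p v)
... | no _  = p v

shortcut : ∀ {n} → Parents n → Parents n
shortcut p v = p (p v)

alter : ∀ {n} → Parents n → List (Edge n) → List (Edge n)
alter p [] = []
alter p (e ∷ es) with p (proj₁ e) ≟ p (proj₂ e)
... | yes _ = alter p es
... | no _  = (p (proj₁ e) , p (proj₂ e)) ∷ alter p es

data Algorithm : Set where
  P E A R RA : Algorithm

round : ∀ {n} → Algorithm → State n → State n
round P (st p es) = st (shortcut (update (parent-connect p es) p)) es
round E (st p es) = st (shortcut (update (extended-connect p es) p)) es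
round A (st p es) =
  let p' = shortcut (update (connect es) p) in st p' (alter p' es)
round R (st p es) = st (shortcut (root-update (parent-connect p es) p)) es
round RA (st p es) =
  let p' = shortcut (root-update (connect es) p) in st p' (alter p' es)

initial : ∀ {n} → List (Edge n) → State n
initial es = st (λ v → v) es

run : ∀ {n} → Algorithm → List (Edge n) → ℕ → State n
run alg es zero    = initial es
run alg es (suc k) = round alg (run alg es k)

-- round number k+1 (applied to the state after k rounds) changes some parent
ChangesParent : ∀ {n} → Algorithm → List (Edge n) → ℕ → Set
ChangesParent {n} alg es k =
  ¬ (∀ (v : Fin n) → par (run alg es (suc k)) v ≡ par (run alg es k) v)

data Connected {n} (es : List (Edge n)) : Fin n → Fin n → Set where
  here  : ∀ {u} → Connected es u u
  fwd   : ∀ {u v w} → (v , w) ∈ es → Connected es u v → Connected es u w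
  bwd   : ∀ {u v w} → (w , v) ∈ es → Connected es u v → Connected es u w

FlatTreePerComponent : ∀ {n} → List (Edge n) → Parents n → Set
FlatTreePerComponent {n} es p =
  (∀ (v : Fin n) → Connected es v (p v) × p (p v) ≡ p v)
  × (∀ (u v : Fin n) → (p u ≡ p v → Connected es u v) × (Connected es u v → p u ≡ p v))

module Submission where

-- Every round replaces the parent function p by  shortcut u, where u is an
-- "update" of p by a list of messages: u lowers parents, every changed
-- parent is a value sent to that vertex, and a root ends up no larger than
-- any value it receives (IsUpdate).
--
-- Parents only decrease and stay in the component of their
--    vertex (Sound).  For A and RA, which rewrite the edge set, AlterInv
--    additionally records that current edges join parents, and that every
--    input edge is still witnessed by a path of current edges and parent
--    links; the latter needs an induction along decreasing parents.
--  * Stable rounds.  If a round leaves all parents unchanged, then u = p,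
--    p is flat, and no root receives a value smaller than itself
--    (AtFixpoint).  For each algorithm this forces the ends of every input
--    edge to have equal parents.
--  * A flat, sound parent function that is constant on input edges is
--    exactly one flat tree per component (flat-trees), which gives theorem4.

open import Defs
open import Data.Nat as ℕ using (ℕ; zero; suc; _<_)
import Data.Nat.Properties as ℕ
open import Data.Fin using (Fin; toℕ; _≟_) renaming (_≤_ to _≤ᵥ_; _<_ to _<ᵥ_)
open import Data.Fin.Properties using (≤-refl; ≤-trans; ≤-antisym; ≤∧≢⇒<)
open import Data.Fin.Induction using (<-wellFounded)
open import Data.Bool using (true; false; if_then_else_)
open import Data.List using (List; []; _∷_; foldr; concatMap)
open import Data.List.Relation.Unary.Any using (here; there)
open import Data.List.Membership.Propositional using (_∈_; find; lose)
open import Data.List.Membership.Propositional.Properties using (∈-concatMap⁺; ∈-concatMap⁻)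
open import Data.Product using (_×_; _,_; proj₁; proj₂; ∃)
import Data.Product as Prod
open import Data.Sum using (_⊎_; inj₁; inj₂)
import Data.Sum as Sum
open import Data.Empty using (⊥-elim)
open import Induction.WellFounded using (Acc; acc)
open import Relation.Nullary using (yes; no; does)
open import Relation.Nullary.Reflects using (ofʸ; ofⁿ)
open import Relation.Binary.Core using (_⇒_; _=[_]⇒_)
open import Relation.Binary.Definitions using (Symmetric)
open import Relation.Binary.PropositionalEquality
open import Relation.Binary.Construct.Closure.ReflexiveTransitive using (ε; _◅_; _◅◅_)
open import Relation.Binary.Construct.Closure.Symmetric using (SymClosure; fwd; bwd)
import Relation.Binary.Construct.Closure.Symmetric as SymClosure
open import Relation.Binary.Construct.Closure.Equivalence using (EqClosure; symmetric; return; join; gmap; gfold; _⋆)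

private
  variable
    n : ℕ

<F-view : (x y : Fin n) → (x <F y ≡ true × x <ᵥ y) ⊎ (x <F y ≡ false × y ≤ᵥ x)
<F-view x y with x <F y | ℕ.<ᵇ-reflects-< (toℕ x) (toℕ y)
... | true  | ofʸ x<y = inj₁ (refl , x<y)
... | false | ofⁿ x≮y = inj₂ (refl , ℕ.≮⇒≥ x≮y)

min-max-view : (x y : Fin n) →
  (minF x y ≡ x × maxF x y ≡ y × x ≤ᵥ y) ⊎ (minF x y ≡ y × maxF x y ≡ x × y <ᵥ x)
min-max-view x y with <F-view y x
... | inj₁ (eq , y<x) rewrite eq = inj₂ (refl , refl , y<x)
... | inj₂ (eq , x≤y) rewrite eq = inj₁ (refl , refl , x≤y)

minF≤ˡ : (x y : Fin n) → minF x y ≤ᵥ x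
minF≤ˡ x y with min-max-view x y
... | inj₁ (eq , _ , _)   rewrite eq = ≤-refl
... | inj₂ (eq , _ , y<x) rewrite eq = ℕ.<⇒≤ y<x

minF≤ʳ : (x y : Fin n) → minF x y ≤ᵥ y
minF≤ʳ x y with min-max-view x y
... | inj₁ (eq , _ , x≤y) rewrite eq = x≤y
... | inj₂ (eq , _ , _)   rewrite eq = ≤-refl

minF-either : (x y : Fin n) → minF x y ≡ x ⊎ minF x y ≡ y
minF-either x y = Sum.map proj₁ proj₁ (min-max-view x y)

maxF-closed : (Q : Fin n → Set) {x y : Fin n} → Q x → Q y → Q (maxF x y)
maxF-closed Q {x} {y} px py with min-max-view x y
... | inj₁ (_ , eq , _) rewrite eq = py
... | inj₂ (_ , eq , _) rewrite eq = px

max≤min⇒≡ : (x y : Fin n) → maxF x y ≤ᵥ minF x y → x ≡ y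
max≤min⇒≡ x y le with min-max-view x y
... | inj₁ (e₁ , e₂ , x≤y) rewrite e₁ | e₂ = ≤-antisym x≤y le
... | inj₂ (e₁ , e₂ , y<x) rewrite e₁ | e₂ = ⊥-elim (ℕ.<⇒≱ y<x le)

orient-preserves : {_∼_ : Fin n → Fin n → Set} → Symmetric _∼_ →
  ∀ {x y} → x ∼ y → maxF x y ∼ minF x y
orient-preserves sym-∼ {x} {y} r with min-max-view x y
... | inj₁ (e₁ , e₂ , _) rewrite e₁ | e₂ = sym-∼ r
... | inj₂ (e₁ , e₂ , _) rewrite e₁ | e₂ = r

-- minSent folds the messages with a boolean view of _≟_ that is local to
-- Defs; we reason about any folding function with the same behaviour.
IsMinStep : Fin n → (Msg n → Fin n → Fin n) → Set
IsMinStep v f = ∀ t x r → f (t , x) r ≡ (if does (t ≟ v) then minF x r else r)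

module MinFold {v : Fin n} {f : Msg n → Fin n → Fin n} (step : IsMinStep v f) (a : Fin n) where

  below-start : ∀ ms → foldr f a ms ≤ᵥ a
  below-start [] = ≤-refl
  below-start ((t , x) ∷ ms) rewrite step t x (foldr f a ms) with t ≟ v
  ... | yes _ = ≤-trans (minF≤ʳ x _) (below-start ms)
  ... | no  _ = below-start ms

  below-received : ∀ ms {x} → (v , x) ∈ ms → foldr f a ms ≤ᵥ x
  below-received ((t , y) ∷ ms) m∈ rewrite step t y (foldr f a ms) with t ≟ v | m∈
  ... | yes _  | here refl = minF≤ˡ y _
  ... | yes _  | there m∈′ = ≤-trans (minF≤ʳ y _) (below-received ms m∈′)
  ... | no t≢v | here refl = ⊥-elim (t≢v refl)
  ... | no _   | there m∈′ = below-received ms m∈′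

  origin : ∀ ms → foldr f a ms ≡ a ⊎ (v , foldr f a ms) ∈ ms
  origin [] = inj₁ refl
  origin ((t , x) ∷ ms) rewrite step t x (foldr f a ms) with t ≟ v
  ... | no _ = Sum.map₂ there (origin ms)
  ... | yes refl with minF-either x (foldr f a ms)
  ...   | inj₁ eq rewrite eq = inj₂ (here refl)
  ...   | inj₂ eq rewrite eq = Sum.map₂ there (origin ms)

-- The folding function of minSent, recovered by unification.
minSent-fold : (ms : List (Msg n)) (v a : Fin n) →
  ∃ λ f → IsMinStep v f × minSent ms v a ≡ foldr f a ms
minSent-fold ms v a = proj₁ unfolded , step , proj₂ unfolded
  where
  unfolded : ∃ λ f → minSent ms v a ≡ foldr f a ms
  unfolded = _ , refl
  step : IsMinStep v (proj₁ unfolded)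
  step t x r with t ≟ v
  ... | yes _ = refl
  ... | no  _ = refl

module _ (ms : List (Msg n)) (v a : Fin n) where
  private
    fold = minSent-fold ms v a
    folds : minSent ms v a ≡ foldr (proj₁ fold) a ms
    folds = proj₂ (proj₂ fold)
  open MinFold (proj₁ (proj₂ fold)) a

  minSent-below-start : minSent ms v a ≤ᵥ a
  minSent-below-start = subst (_≤ᵥ a) (sym folds) (below-start ms)

  minSent-below-received : ∀ {x} → (v , x) ∈ ms → minSent ms v a ≤ᵥ x
  minSent-below-received m∈ = subst (_≤ᵥ _) (sym folds) (below-received ms m∈)

  minSent-origin : minSent ms v a ≡ a ⊎ (v , minSent ms v a) ∈ ms
  minSent-origin = subst (λ z → z ≡ a ⊎ (v , z) ∈ ms) (sym folds) (origin ms)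

record IsUpdate (p u : Parents n) (M : List (Msg n)) : Set where
  field
    lowers   : ∀ v → u v ≤ᵥ p v
    origin   : ∀ v → u v ≡ p v ⊎ (v , u v) ∈ M
    root-min : ∀ {t x} → (t , x) ∈ M → p t ≡ t → u t ≤ᵥ x

update-isUpdate : (M : List (Msg n)) (p : Parents n) → IsUpdate p (update M p) M
update-isUpdate M p = record
  { lowers   = λ v → minSent-below-start M v (p v)
  ; origin   = λ v → minSent-origin M v (p v)
  ; root-min = λ {t} m∈ _ → minSent-below-received M t (p t) m∈
  }

root-update-isUpdate : (M : List (Msg n)) (p : Parents n) → IsUpdate p (root-update M p) M
root-update-isUpdate M p = record { lowers = lowers ; origin = origin ; root-min = root-min }
  where
  lowers : ∀ v → root-update M p v ≤ᵥ p v
  lowers v with p v ≟ v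
  ... | yes _ = minSent-below-start M v (p v)
  ... | no  _ = ≤-refl

  origin : ∀ v → root-update M p v ≡ p v ⊎ (v , root-update M p v) ∈ M
  origin v with p v ≟ v
  ... | yes _ = minSent-origin M v (p v)
  ... | no  _ = inj₁ refl

  root-min : ∀ {t x} → (t , x) ∈ M → p t ≡ t → root-update M p t ≤ᵥ x
  root-min {t} m∈ root with p t ≟ t
  ... | yes _        = minSent-below-received M t (p t) m∈
  ... | no  not-root = ⊥-elim (not-root root)

module _ {es : List (Edge n)} where

  connected-trans : ∀ {x y z} → Connected es x y → Connected es y z → Connected es x z
  connected-trans c here        = c
  connected-trans c (fwd e∈ c′) = fwd e∈ (connected-trans c c′)
  connected-trans c (bwd e∈ c′) = bwd e∈ (connected-trans c c′)

  connected-sym : ∀ {x y} → Connected es x y → Connected es y x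
  connected-sym here       = here
  connected-sym (fwd e∈ c) = connected-trans (bwd e∈ here) (connected-sym c)
  connected-sym (bwd e∈ c) = connected-trans (fwd e∈ here) (connected-sym c)

parents-linked : {es : List (Edge n)} {p : Parents n} → (∀ v → Connected es v (p v)) →
  ∀ {a b} → Connected es a b → Connected es (p a) (p b)
parents-linked linked {a} {b} a~b = connected-trans (connected-sym (linked a)) (connected-trans a~b (linked b))

Merges : List (Edge n) → (Fin n → Fin n) → Set
Merges Es f = ∀ {a b} → (a , b) ∈ Es → f a ≡ f b

connected-merged : {es : List (Edge n)} {f : Fin n → Fin n} → Merges es f →
  ∀ {x y} → Connected es x y → f x ≡ f y
connected-merged merges here       = refl
connected-merged merges (fwd e∈ c) = trans (connected-merged merges c) (merges e∈)
connected-merged merges (bwd e∈ c) = trans (connected-merged merges c) (sym (merges e∈))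

flat-trees : {es : List (Edge n)} {p : Parents n} →
  (∀ v → Connected es v (p v)) → (∀ v → p (p v) ≡ p v) → Merges es p →
  FlatTreePerComponent es p
flat-trees {es = es} {p} linked flat merges =
  (λ v → linked v , flat v) ,
  λ u v → (λ same → connected-trans (linked u)
                       (subst (λ z → Connected es z v) (sym same) (connected-sym (linked v))))
          , connected-merged merges

flat-trees-resp : {es : List (Edge n)} {p q : Parents n} → (∀ v → q v ≡ p v) →
  FlatTreePerComponent es p → FlatTreePerComponent es q
flat-trees-resp {es = es} {p} {q} q≗p (trees , components) =
  (λ v → subst (Connected es v) (sym (q≗p v)) (proj₁ (trees v)) , q-flat v) ,
  λ u v → (λ same → proj₁ (components u v) (trans (sym (q≗p u)) (trans same (q≗p v))))
        , (λ c → trans (q≗p u) (trans (proj₂ (components u v) c) (sym (q≗p v))))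
  where
  q-flat : ∀ v → q (q v) ≡ q v
  q-flat v = begin
    q (q v) ≡⟨ q≗p (q v) ⟩
    p (q v) ≡⟨ cong p (q≗p v) ⟩
    p (p v) ≡⟨ proj₂ (trees v) ⟩
    p v     ≡⟨ sym (q≗p v) ⟩
    q v     ∎
    where open ≡-Reasoning

record Sound (es : List (Edge n)) (p : Parents n) : Set where
  field
    decreasing : ∀ v → p v ≤ᵥ v
    linked     : ∀ v → Connected es v (p v)

sound-initial : (es : List (Edge n)) → Sound es (λ v → v)
sound-initial es = record { decreasing = λ _ → ≤-refl ; linked = λ _ → here }

MessagesLinked : List (Edge n) → List (Msg n) → Set
MessagesLinked es M = ∀ {t x} → (t , x) ∈ M → Connected es t x

sound-step : {es : List (Edge n)} {p u : Parents n} {M : List (Msg n)} →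
  IsUpdate p u M → MessagesLinked es M → Sound es p → Sound es (shortcut u)
sound-step {es = es} {p} {u} U msgs-linked S = record
  { decreasing = λ v → ≤-trans (u-decreasing (u v)) (u-decreasing v)
  ; linked     = λ v → connected-trans (u-linked v) (u-linked (u v))
  }
  where
  open IsUpdate U
  open Sound S
  u-decreasing : ∀ v → u v ≤ᵥ v
  u-decreasing v = ≤-trans (lowers v) (decreasing v)
  u-linked : ∀ v → Connected es v (u v)
  u-linked v with origin v
  ... | inj₁ u≡p = subst (Connected es v) (sym u≡p) (linked v)
  ... | inj₂ m∈  = msgs-linked m∈

RootsUnimproved : Parents n → List (Msg n) → Set
RootsUnimproved p M = ∀ {t x} → (t , x) ∈ M → p t ≡ t → t ≤ᵥ x

module AtFixpoint {p u : Parents n} {M : List (Msg n)} (U : IsUpdate p u M)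
                  (decreasing : ∀ v → p v ≤ᵥ v) (fixed : ∀ v → shortcut u v ≡ p v) where
  open IsUpdate U

  u≗p : ∀ v → u v ≡ p v
  u≗p v = ≤-antisym (lowers v) (subst (_≤ᵥ u v) (fixed v) (≤-trans (lowers (u v)) (decreasing (u v))))

  flat : ∀ v → p (p v) ≡ p v
  flat v = ≤-antisym (decreasing (p v)) (subst (_≤ᵥ p (p v)) u-at-parent (lowers (p v)))
    where
    u-at-parent : u (p v) ≡ p v
    u-at-parent = trans (cong u (sym (u≗p v))) (fixed v)

  roots-unimproved : RootsUnimproved p M
  roots-unimproved m∈ root = subst (_≤ᵥ _) (trans (u≗p _) root) (root-min m∈ root)

correct-at-fixpoint : {es : List (Edge n)} {p u : Parents n} {M : List (Msg n)} →
  IsUpdate p u M → Sound es p → (∀ v → shortcut u v ≡ p v) →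
  ((∀ v → p (p v) ≡ p v) → RootsUnimproved p M → Merges es p) →
  FlatTreePerComponent es (shortcut u)
correct-at-fixpoint U S fixed merges =
  flat-trees-resp fixed (flat-trees linked flat (merges flat roots-unimproved))
  where
  open Sound S
  open AtFixpoint U decreasing fixed

orient : Edge n → Msg n
orient (x , y) = (maxF x y , minF x y)

-- One oriented message per edge, along the pair g e;  connect Es is the
-- case g = id, and parent-connect p Es the case g = parents-of p.
OrientedMessages : (Edge n → Edge n) → List (Edge n) → List (Msg n)
OrientedMessages g = concatMap (λ e → orient (g e) ∷ [])

parents-of : Parents n → Edge n → Edge n
parents-of p (a , b) = (p a , p b)

module _ {g : Edge n → Edge n} {Es : List (Edge n)} where

  oriented-sent : ∀ {e} → e ∈ Es → orient (g e) ∈ OrientedMessages g Es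
  oriented-sent e∈ = ∈-concatMap⁺ _ (lose e∈ (here refl))

  oriented-source : ∀ {m} → m ∈ OrientedMessages g Es → ∃ λ e → e ∈ Es × m ≡ orient (g e)
  oriented-source m∈ with find (∈-concatMap⁻ (λ e → orient (g e) ∷ []) m∈)
  ... | e , e∈ , here refl = e , e∈ , refl

  oriented-linked : {es : List (Edge n)} →
    (∀ {e} → e ∈ Es → Connected es (proj₁ (g e)) (proj₂ (g e))) →
    MessagesLinked es (OrientedMessages g Es)
  oriented-linked {es} pairs-linked m∈ with oriented-source m∈
  ... | e , e∈ , refl = orient-preserves {_∼_ = Connected es} connected-sym (pairs-linked e∈)

  oriented-merges : {p : Parents n} → RootsUnimproved p (OrientedMessages g Es) →
    ∀ {e} → e ∈ Es → let (x , y) = g e in p x ≡ x → p y ≡ y → x ≡ y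
  oriented-merges {p} unimproved {e} e∈ x-root y-root =
    max≤min⇒≡ _ _ (unimproved (oriented-sent e∈) (maxF-closed (λ z → p z ≡ z) x-root y-root))

EdgeOf : List (Edge n) → Fin n → Fin n → Set
EdgeOf Es a b = (a , b) ∈ Es

connect-message-edge : {Es : List (Edge n)} → ∀ {t x} → (t , x) ∈ connect Es →
  SymClosure (EdgeOf Es) t x
connect-message-edge {Es = Es} m∈ with oriented-source {g = λ e → e} {Es} m∈
... | (a , b) , e∈ , refl = orient-preserves (SymClosure.symmetric _) {a} {b} (fwd e∈)

connect-linked : {es Es : List (Edge n)} →
  (∀ {a b} → (a , b) ∈ Es → Connected es a b) → MessagesLinked es (connect Es)
connect-linked edges-linked = oriented-linked {g = λ e → e} edges-linked

parent-connect-linked : {es Es : List (Edge n)} {p : Parents n} →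
  (∀ v → Connected es v (p v)) → (∀ {a b} → (a , b) ∈ Es → Connected es a b) →
  MessagesLinked es (parent-connect p Es)
parent-connect-linked {p = p} linked edges-linked =
  oriented-linked {g = parents-of p} (λ e∈ → parents-linked linked (edges-linked e∈))

parent-connect-merges : {Es : List (Edge n)} {p : Parents n} →
  (∀ v → p (p v) ≡ p v) → RootsUnimproved p (parent-connect p Es) → Merges Es p
parent-connect-merges {p = p} flat unimproved {a} {b} e∈ =
  oriented-merges {g = parents-of p} unimproved e∈ (flat a) (flat b)

-- The two messages extended-connect sends for one edge (a , b), so that
-- extended-connect p = concatMap (extended-messages p) by definition: the
-- smaller parent is sent to the larger parent and to the edge end owning it.
extended-messages : Parents n → Edge n → List (Msg n)
extended-messages p (a , b) =
  if p b <F p a then (a , p b) ∷ (p a , p b) ∷ [] else (b , p a) ∷ (p b , p a) ∷ []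

extended-sent : {Es : List (Edge n)} {p : Parents n} → ∀ {e m} →
  e ∈ Es → m ∈ extended-messages p e → m ∈ extended-connect p Es
extended-sent {p = p} e∈ m∈ = ∈-concatMap⁺ (extended-messages p) (lose e∈ m∈)

extended-linked : {es Es : List (Edge n)} {p : Parents n} →
  (∀ v → Connected es v (p v)) → (∀ {a b} → (a , b) ∈ Es → Connected es a b) →
  MessagesLinked es (extended-connect p Es)
extended-linked {es = es} {p = p} linked edges-linked m∈
  with find (∈-concatMap⁻ (extended-messages p) m∈)
... | (a , b) , e∈ , m∈′ = edge-messages (edges-linked e∈) m∈′
  where
  edge-messages : Connected es a b → MessagesLinked es (extended-messages p (a , b))
  edge-messages a~b m∈ with p b <F p a | m∈
  ... | true  | here refl         = connected-trans a~b (linked b)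
  ... | true  | there (here refl) = parents-linked linked a~b
  ... | false | here refl         = connected-trans (connected-sym a~b) (linked a)
  ... | false | there (here refl) = connected-sym (parents-linked linked a~b)

extended-parent-message : (p : Parents n) (a b : Fin n) →
  (p b <ᵥ p a × (p a , p b) ∈ extended-messages p (a , b)) ⊎
  (p a ≤ᵥ p b × (p b , p a) ∈ extended-messages p (a , b))
extended-parent-message p a b with <F-view (p b) (p a)
... | inj₁ (eq , lt) rewrite eq = inj₁ (lt , there (here refl))
... | inj₂ (eq , le) rewrite eq = inj₂ (le , there (here refl))

extended-connect-merges : {Es : List (Edge n)} {p : Parents n} →
  (∀ v → p (p v) ≡ p v) → RootsUnimproved p (extended-connect p Es) → Merges Es p
extended-connect-merges {p = p} flat unimproved {a} {b} e∈ with extended-parent-message p a b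
... | inj₁ (lt , m∈) = ⊥-elim (ℕ.<⇒≱ lt (unimproved (extended-sent e∈ m∈) (flat a)))
... | inj₂ (le , m∈) = ≤-antisym le (unimproved (extended-sent e∈ m∈) (flat b))

alter-source : (q : Parents n) (Es : List (Edge n)) → ∀ {m} →
  m ∈ alter q Es → ∃ λ e → e ∈ Es × m ≡ parents-of q e
alter-source q ((a , b) ∷ Es) m∈ with q a ≟ q b | m∈
... | yes _ | m∈′       = Prod.map₂ (Prod.map₁ there) (alter-source q Es m∈′)
... | no _  | here refl = (a , b) , here refl , refl
... | no _  | there m∈′ = Prod.map₂ (Prod.map₁ there) (alter-source q Es m∈′)

alter-image : (q : Parents n) (Es : List (Edge n)) → ∀ {a b} →
  (a , b) ∈ Es → q a ≡ q b ⊎ (q a , q b) ∈ alter q Es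
alter-image q ((a , b) ∷ Es) e∈ with q a ≟ q b | e∈
... | yes qa≡qb | here refl = inj₁ qa≡qb
... | yes _     | there e∈′ = alter-image q Es e∈′
... | no _      | here refl = inj₂ (here refl)
... | no _      | there e∈′ = Sum.map₂ there (alter-image q Es e∈′)

Endpoint : List (Edge n) → Fin n → Set
Endpoint Es z = ∃ λ w → SymClosure (EdgeOf Es) z w

endpoint-along : {Es : List (Edge n)} → ∀ {a b} →
  Endpoint Es a → EqClosure (EdgeOf Es) a b → Endpoint Es b
endpoint-along {Es = Es} end path with symmetric (EdgeOf Es) path
... | ε         = end
... | step ◅ _  = _ , step

ParentOrEdge : Parents n → List (Edge n) → Fin n → Fin n → Set
ParentOrEdge p Es x y = (x , y) ∈ Es ⊎ p x ≡ y

InImage : Parents n → Fin n → Set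
InImage p x = ∃ λ z → p z ≡ x

record AlterInv (es : List (Edge n)) (p : Parents n) (Es : List (Edge n)) : Set where
  field
    sound        : Sound es p
    edges-linked : ∀ {x y} → (x , y) ∈ Es → Connected es x y
    ends-parents : ∀ {x y} → (x , y) ∈ Es → InImage p x × InImage p y
    covered      : ∀ {a b} → (a , b) ∈ es → EqClosure (ParentOrEdge p Es) a b
    ends-reach   : ∀ {z} → Endpoint Es z → EqClosure (EdgeOf Es) z (p z)
  open Sound sound public

alter-initial : (es : List (Edge n)) → AlterInv es (λ v → v) es
alter-initial es = record
  { sound        = sound-initial es
  ; edges-linked = λ e∈ → fwd e∈ here
  ; ends-parents = λ {x} {y} _ → (x , refl) , (y , refl)
  ; covered      = λ e∈ → return (inj₁ e∈)
  ; ends-reach   = λ _ → ε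
  }

module AlterStep {es Es : List (Edge n)} {p u : Parents n}
                 (U : IsUpdate p u (connect Es)) (I : AlterInv es p Es) where
  open IsUpdate U
  open AlterInv I

  p′ : Parents n
  p′ = shortcut u

  Es′ : List (Edge n)
  Es′ = alter p′ Es

  _~_ : Fin n → Fin n → Set
  _~_ = EqClosure (ParentOrEdge p′ Es′)

  sound′ : Sound es p′
  sound′ = sound-step U (connect-linked edges-linked) sound

  to-parent : ∀ v → v ~ p′ v
  to-parent v = return (inj₂ refl)

  edge-covered : EdgeOf Es ⇒ _~_
  edge-covered {x} {y} e∈ = to-parent x ◅◅ images ◅◅ symmetric _ (to-parent y)
    where
    images : p′ x ~ p′ y
    images with alter-image p′ Es e∈
    ... | inj₁ same = subst (p′ x ~_) same ε
    ... | inj₂ e∈′  = return (inj₁ e∈′)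

  sym-edge-covered : SymClosure (EdgeOf Es) ⇒ _~_
  sym-edge-covered (fwd e∈) = edge-covered e∈
  sym-edge-covered (bwd e∈) = symmetric _ (edge-covered e∈)

  towards-update : ∀ y → y ~ p y → y ~ u y
  towards-update y y~py with origin y
  ... | inj₁ uy≡py = subst (y ~_) (sym uy≡py) y~py
  ... | inj₂ m∈    = sym-edge-covered (connect-message-edge m∈)

  -- An old parent link is covered; if x is not a root and was not updated,
  -- go x → p′ x = u (p x) and back to p x, by induction along p x < x.
  parent-covered : ∀ x → Acc _<ᵥ_ x → x ~ p x
  parent-covered x (acc smaller) with origin x | p x ≟ x
  ... | inj₂ m∈    | _          = (edge-covered ⋆) (ends-reach (u x , connect-message-edge m∈))
  ... | inj₁ _     | yes root   = subst (x ~_) (sym root) ε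
  ... | inj₁ ux≡px | no not-root =
    to-parent x ◅◅ subst (λ z → u z ~ p x) (sym ux≡px) (symmetric _ (towards-update (p x) px~ppx))
    where
    px~ppx : p x ~ p (p x)
    px~ppx = parent-covered (p x) (smaller (≤∧≢⇒< (decreasing x) not-root))

  step-covered : ParentOrEdge p Es ⇒ _~_
  step-covered (inj₁ e∈)   = edge-covered e∈
  step-covered (inj₂ refl) = parent-covered _ (<-wellFounded _)

  reach-update : ∀ {z} → Endpoint Es z → EqClosure (EdgeOf Es) z (u z)
  reach-update {z} end with origin z
  ... | inj₁ uz≡pz = subst (EqClosure (EdgeOf Es) z) (sym uz≡pz) (ends-reach end)
  ... | inj₂ m∈    = connect-message-edge m∈ ◅ ε

  reach-shortcut : ∀ {z} → Endpoint Es z → EqClosure (EdgeOf Es) z (p′ z)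
  reach-shortcut end = let to-u = reach-update end in to-u ◅◅ reach-update (endpoint-along end to-u)

  edge-image : EdgeOf Es =[ p′ ]⇒ EqClosure (EdgeOf Es′)
  edge-image e∈ with alter-image p′ Es e∈
  ... | inj₁ same = subst (EqClosure (EdgeOf Es′) _) same ε
  ... | inj₂ e∈′  = return e∈′

  path-image : ∀ {x y} → EqClosure (EdgeOf Es) x y → EqClosure (EdgeOf Es′) (p′ x) (p′ y)
  path-image path = join (gmap p′ edge-image path)

  ends-reach′ : ∀ {z} → Endpoint Es′ z → EqClosure (EdgeOf Es′) z (p′ z)
  ends-reach′ (_ , fwd m∈) with alter-source p′ Es m∈
  ... | (a , b) , e∈ , refl = path-image (reach-shortcut (b , fwd e∈))
  ends-reach′ (_ , bwd m∈) with alter-source p′ Es m∈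
  ... | (a , b) , e∈ , refl = path-image (reach-shortcut (a , bwd e∈))

  invariant′ : AlterInv es p′ Es′
  invariant′ = record
    { sound        = sound′
    ; edges-linked = λ m∈ → new-edge-linked (alter-source p′ Es m∈)
    ; ends-parents = λ m∈ → new-edge-ends (alter-source p′ Es m∈)
    ; covered      = λ e∈ → (step-covered ⋆) (covered e∈)
    ; ends-reach   = ends-reach′
    }
    where
    new-edge-linked : ∀ {x y} → (∃ λ e → e ∈ Es × (x , y) ≡ parents-of p′ e) → Connected es x y
    new-edge-linked (_ , e∈ , refl) = parents-linked (Sound.linked sound′) (edges-linked e∈)
    new-edge-ends : ∀ {x y} → (∃ λ e → e ∈ Es × (x , y) ≡ parents-of p′ e) → InImage p′ x × InImage p′ y
    new-edge-ends ((a , b) , _ , refl) = (a , refl) , (b , refl)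

-- At a stable round of A or RA, every current edge is a loop, so the
-- paths witnessing the input edges are merged by p.
alter-merges : {es Es : List (Edge n)} {p : Parents n} → AlterInv es p Es →
  (∀ v → p (p v) ≡ p v) → RootsUnimproved p (connect Es) → Merges es p
alter-merges {p = p} I flat unimproved e∈ = gfold isEquivalence p step-merged (covered e∈)
  where
  open AlterInv I
  image-root : ∀ {x} → InImage p x → p x ≡ x
  image-root (z , refl) = flat z
  step-merged : ParentOrEdge p _ =[ p ]⇒ _≡_
  step-merged (inj₁ e∈′) = cong p (oriented-merges {g = λ e → e} unimproved e∈′
    (image-root (proj₁ (ends-parents e∈′))) (image-root (proj₂ (ends-parents e∈′))))
  step-merged (inj₂ refl) = sym (flat _)

Invariant : Algorithm → List (Edge n) → State n → Set
Invariant P  es s = edges s ≡ es × Sound es (par s)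
Invariant E  es s = edges s ≡ es × Sound es (par s)
Invariant R  es s = edges s ≡ es × Sound es (par s)
Invariant A  es s = AlterInv es (par s) (edges s)
Invariant RA es s = AlterInv es (par s) (edges s)

input-edges-linked : {es Es : List (Edge n)} → Es ≡ es → ∀ {a b} → (a , b) ∈ Es → Connected es a b
input-edges-linked refl e∈ = fwd e∈ here

invariant-initial : ∀ alg (es : List (Edge n)) → Invariant alg es (initial es)
invariant-initial P  es = refl , sound-initial es
invariant-initial E  es = refl , sound-initial es
invariant-initial R  es = refl , sound-initial es
invariant-initial A  es = alter-initial es
invariant-initial RA es = alter-initial es

invariant-round : ∀ alg {es : List (Edge n)} {s} → Invariant alg es s → Invariant alg es (round alg s)
invariant-round P  (same , S) = same , sound-step (update-isUpdate _ _)
  (parent-connect-linked (Sound.linked S) (input-edges-linked same)) S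
invariant-round E  (same , S) = same , sound-step (update-isUpdate _ _)
  (extended-linked (Sound.linked S) (input-edges-linked same)) S
invariant-round R  (same , S) = same , sound-step (root-update-isUpdate _ _)
  (parent-connect-linked (Sound.linked S) (input-edges-linked same)) S
invariant-round A  I = AlterStep.invariant′ (update-isUpdate _ _) I
invariant-round RA I = AlterStep.invariant′ (root-update-isUpdate _ _) I

invariant-run : ∀ alg (es : List (Edge n)) k → Invariant alg es (run alg es k)
invariant-run alg es zero    = invariant-initial alg es
invariant-run alg es (suc k) = invariant-round alg (invariant-run alg es k)

merges-input : {es Es : List (Edge n)} {p : Parents n} → Es ≡ es → Merges Es p → Merges es p
merges-input refl merges = merges

stable-round-correct : ∀ alg {es : List (Edge n)} {s} → Invariant alg es s →
  (∀ v → par (round alg s) v ≡ par s v) → FlatTreePerComponent es (par (round alg s))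
stable-round-correct P (same , S) fixed = correct-at-fixpoint (update-isUpdate _ _) S fixed
  λ flat unimproved → merges-input same (parent-connect-merges flat unimproved)
stable-round-correct E (same , S) fixed = correct-at-fixpoint (update-isUpdate _ _) S fixed
  λ flat unimproved → merges-input same (extended-connect-merges flat unimproved)
stable-round-correct R (same , S) fixed = correct-at-fixpoint (root-update-isUpdate _ _) S fixed
  λ flat unimproved → merges-input same (parent-connect-merges flat unimproved)
stable-round-correct A I fixed =
  correct-at-fixpoint (update-isUpdate _ _) (AlterInv.sound I) fixed (alter-merges I)
stable-round-correct RA I fixed =
  correct-at-fixpoint (root-update-isUpdate _ _) (AlterInv.sound I) fixed (alter-merges I)

theorem4 : (alg : Algorithm) (n : ℕ) (es : List (Edge n)) (k : ℕ)
    → (∀ j → j < k → ChangesParent alg es j)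
    → (∀ (v : Fin n) → par (run alg es (suc k)) v ≡ par (run alg es k) v)
    → FlatTreePerComponent es (par (run alg es (suc k)))
theorem4 alg n es k _ stable = stable-round-correct alg (invariant-run alg es k) stable
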